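{- Let $\alpha$ be a composition and $k$ a positive integer. For any $\pi\in\mathcal{OP}_{\alpha,k}$, written as a descent-starred permutation $(\sigma,S)$, let $\psi_{\alpha,k}(\pi)$ be written as the descent-starred permutation $(\tau,T)$. Then $\sigma$ and $\tau$ have the same right-to-left minima. In particular, the last entries of $\sigma$ and $\tau$ are equal.
   Context: A composition $\alpha=(\alpha_1,\dots,\alpha_n)$ is a sequence of positive integers, $|\alpha|=\sum\alpha_i$, $\alpha^-=(\alpha_1,\dots,\alpha_{n-1})$. $\mathcal{OP}_{\alpha,k}$ is the set of ordered partitions of the multiset $\{i^{\alpha_i}\}$ into $k$ blocks, each a nonempty set. An ordered multiset partition is identified with a descent-starred permutation $(\sigma,S)$: $\sigma$ is the concatenation of the blocks each written in decreasing order, and $S$ is the set of positions $g$ with $\sigma_g,\sigma_{g+1}$ in the same block (starred descents). A right-to-left minimum of a word $\sigma$ is an entry $\sigma_i$ with $\sigma_i<\sigma_j$ for all $j>i$. $\binom{S}{m}$: $m$-subsets; $\left(\!\binom{S}{m}\!\right)$: $m$-element multisets; $[a,b]$ integer interval. Map $\phi^{\operatorname{inv}}_{\alpha,k,\ell}(\pi,U,B)$ for $\pi\in\mathcal{OP}_{\alpha^-,\ell}$, $U\in\binom{[0,\ell-1]}{\alpha_n-k+\ell}$, $B\in\left(\!\binom{[0,\ell]}{k-\ell}\!\right)$: label the blocks of $\pi$ right to left by $0,\dots,\ell-1$; repeatedly remove a largest $i$ from $U\uplus B$ (from $U$ on ties); if from $U$, add $n$ to the block labeled $i$; if from $B$ and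 $i=\ell$, add a new block $\{n\}$ at the far left; if from $B$ and $i<\ell$, add a new block $\{n\}$ immediately right of the block labeled $i$. It is injective with image the $\rho\in\mathcal{OP}_{\alpha,k}$ having exactly $k-\ell$ singleton blocks $\{n\}$. Map $\phi^{\operatorname{maj}}_{\alpha,k,\ell}(\pi,U,B)$ (same domain): writing $\pi=(\sigma,S)$ of length $N$, label gaps $0,\dots,N$ (gap $g$ between $\sigma_g$ and $\sigma_{g+1}$): gap $N$ gets $0$; unstarred descent gaps right to left get $1,2,\dots$; gap $0$ the next label; non-descent gaps $1\le g\le N-1$ left to right the following labels. With $U^+=\{u+1:u\in U\}$, repeatedly remove a largest $i$ from $U^+\uplus B$ (from $B$ on ties): insert $n$ into the gap labeled $i$; move each star to the right of the new $n$ to the nearest descent on its left; if $i$ came from $U^+$, star the rightmost descent; relabel. The final starred word is the output. $\psi_{\alpha,k}$: identity when $\alpha$ has length $1$; otherwise for $\rho\in\mathcal{OP}_{\alpha,k}$, $\ell=k-\#\{\text{blocks of }\rho\text{ equal to }\{n\}\}$, $(\pi,U,B)=(\phi^{\operatorname{inv}}_{\alpha,k,\ell})^{ -1}(\rho)$, and $\psi_{\alpha,k}(\rho)=\phi^{\operatorname{maj}}_{\alpha,k,\ell}(\psi_{\alpha^-,\ell}(\pi),U,B)$. -}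

module Defs where

open import Data.Nat using (ℕ; zero; suc; _+_; _∸_; _<_; _≤_; _>_; _<ᵇ_; _≡ᵇ_)
open import Data.Bool using (Bool; true; false; if_then_else_; _∧_; not)
open import Data.List using (List; []; _∷_; _++_; length; map; concat; concatMap;
  reverse; filterᵇ; applyUpTo; downFrom; replicate; take; drop; foldl; last)
open import Data.List.Relation.Unary.All using (All)
open import Data.List.Relation.Unary.Linked using (Linked)
open import Data.Bool.ListAction using (any; all)
open import Data.Maybe using (Maybe; just; nothing)
open import Data.Product using (_×_; _,_; proj₁; proj₂)
open import Data.Fin using (Fin; toℕ)
open import Relation.Binary.PropositionalEquality using (_≡_; _≢_)

-- 1-indexed entry of a word (default 0 when out of range)
ent : List ℕ → ℕ → ℕ
ent []       _             = 0
ent (x ∷ xs) zero          = 0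
ent (x ∷ xs) (suc zero)    = x
ent (x ∷ xs) (suc (suc i)) = ent xs (suc i)

at0 : List ℕ → ℕ → ℕ
at0 []       _       = 0
at0 (x ∷ xs) zero    = x
at0 (x ∷ xs) (suc i) = at0 xs i

mem : ℕ → List ℕ → Bool
mem x = any (λ y → y ≡ᵇ x)

countℕ : ℕ → List ℕ → ℕ
countℕ x xs = length (filterᵇ (λ y → y ≡ᵇ x) xs)

-- A block (a nonempty set of positive integers) is represented canonically
-- as a nonempty strictly decreasing list; an ordered multiset partition is
-- the list of its blocks from left to right.

Block : Set
Block = List ℕ

OMP : Set
OMP = List Block

StrictDecr : List ℕ → Set
StrictDecr = Linked _>_

record IsOP (α : List ℕ) (k : ℕ) (ρ : OMP) : Set where
  field
    numBlocks : length ρ ≡ k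
    blocksNonempty : All (λ b → b ≢ []) ρ
    blocksSets : All StrictDecr ρ
    entriesInRange : All (All (λ x → 1 ≤ x × x ≤ length α)) ρ
    multiplicities : (i : Fin (length α)) →
      countℕ (suc (toℕ i)) (concat ρ) ≡ Data.List.lookup α i

IsComposition : List ℕ → Set
IsComposition = All (λ a → 0 < a)

-- Descent-starred permutations (σ , S): word σ and set S of starred
-- positions g (1-indexed gap between σ_g and σ_{g+1}), S as a list.

StarredWord : Set
StarredWord = List ℕ × List ℕ

starsAux : ℕ → OMP → List ℕ
starsAux o []       = []
starsAux o (b ∷ bs) = applyUpTo (λ j → o + suc j) (length b ∸ 1) ++ starsAux (o + length b) bs

-- blocks are already written in decreasing order
toStarred : OMP → StarredWord
toStarred ρ = concat ρ , starsAux 0 ρ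

isDesc : List ℕ → ℕ → Bool
isDesc σ g = ent σ (suc g) <ᵇ ent σ g

innerGaps : List ℕ → List ℕ
innerGaps σ = applyUpTo suc (length σ ∸ 1)

descGaps : List ℕ → List ℕ
descGaps σ = filterᵇ (isDesc σ) (innerGaps σ)

-- the list of gaps in label order: entry i is the gap labelled i
labelledGaps : StarredWord → List ℕ
labelledGaps (σ , S) =
  length σ
  ∷ reverse (filterᵇ (λ g → isDesc σ g ∧ not (mem g S)) (innerGaps σ))
  ++ (0 ∷ filterᵇ (λ g → not (isDesc σ g)) (innerGaps σ))

gapOf : StarredWord → ℕ → ℕ
gapOf w i = at0 (labelledGaps w) i

insertWord : ℕ → ℕ → List ℕ → List ℕ
insertWord g n σ = take g σ ++ (n ∷ drop g σ)

prevDesc : List ℕ → ℕ → Maybe ℕ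
prevDesc σ p = last (filterᵇ (λ d → d <ᵇ p) (descGaps σ))

maybeList : Maybe ℕ → List ℕ
maybeList nothing  = []
maybeList (just x) = x ∷ []

-- new star set after inserting n into gap g (σ' is the new word):
-- stars left of n stay; a star right of n (old gap s > g, new gap s+1)
-- moves to the nearest descent on its left.
moveStars : ℕ → List ℕ → List ℕ → List ℕ
moveStars g σ' S =
  concatMap (λ s → if s <ᵇ suc g then s ∷ [] else maybeList (prevDesc σ' (suc s))) S

-- one insertion step of φ^maj: (label i, whether it came from U⁺)
majStep : ℕ → StarredWord → ℕ × Bool → StarredWord
majStep n (σ , S) (i , fromU) =
  let g  = gapOf (σ , S) i
      σ' = insertWord g n σ
      S1 = moveStars g σ' S
  in σ' , (if fromU then S1 ++ maybeList (last (descGaps σ')) else S1)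

-- order of removal from U⁺ ⊎ B: largest first, B before U⁺ on ties
majSequence : ℕ → List ℕ → List ℕ → List (ℕ × Bool)
majSequence ℓ U⁺ B =
  concatMap (λ i → replicate (countℕ i B) (i , false)
                   ++ (if mem i U⁺ then (i , true) ∷ [] else []))
            (downFrom (suc ℓ))

phiMaj : ℕ → ℕ → StarredWord → List ℕ → List ℕ → StarredWord
phiMaj n ℓ w U B = foldl (majStep n) w (majSequence ℓ (map suc U) B)

-- Blocks of π are labelled right to left 0,1,…; a block containing n
-- (other than {n}) contributes its label to U; a singleton {n} contributes
-- to B the label of the nearest non-{n} block to its left (= number of
-- non-{n} blocks to its right; ℓ if there is none to its left).

isSingleton : ℕ → Block → Bool
isSingleton n (x ∷ []) = x ≡ᵇ n
isSingleton n _        = false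

removeLetter : ℕ → Block → Block
removeLetter n = filterᵇ (λ y → not (y ≡ᵇ n))

-- processes the blocks from right to left; c = label counter
invAux : ℕ → ℕ → OMP → OMP × List ℕ × List ℕ
invAux n c [] = [] , [] , []
invAux n c (b ∷ bs) with isSingleton n b
... | true  = let (p , u , bb) = invAux n c bs in p , u , c ∷ bb
... | false with mem n b
...   | true  = let (p , u , bb) = invAux n (suc c) bs in removeLetter n b ∷ p , c ∷ u , bb
...   | false = let (p , u , bb) = invAux n (suc c) bs in b ∷ p , u , bb

phiInvInverse : ℕ → OMP → OMP × List ℕ × List ℕ
phiInvInverse n ρ = let (p , u , bb) = invAux n 0 (reverse ρ) in reverse p , u , bb

psiAux : ℕ → ℕ → OMP → StarredWord
psiAux zero          k ρ = toStarred ρ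
psiAux (suc zero)    k ρ = toStarred ρ
psiAux (suc (suc m)) k ρ =
  let n = suc (suc m)
      (π , U , B) = phiInvInverse n ρ
      ℓ = k ∸ length B
  in phiMaj n ℓ (psiAux (suc m) ℓ π) U B

psi : List ℕ → ℕ → OMP → StarredWord
psi α k ρ = psiAux (length α) k ρ

-- Right-to-left minima (values, in left-to-right order)

rlMin : List ℕ → List ℕ
rlMin []       = []
rlMin (x ∷ xs) = if all (λ y → x <ᵇ y) xs then x ∷ rlMin xs else rlMin xs

-- Write n for the largest letter. Being larger than every other letter, n is a
-- right-to-left minimum of a word exactly when it is the last letter, and deleting
-- the copies of n does not change which other letters are right-to-left minima.
-- Undoing φ^inv deletes the copies of n from σ, and φ^maj only inserts copies of n,
-- so by induction on the length of α it remains to see that σ and τ end in the same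
-- letter. If the last block of ρ is {n}, then 0 ∈ B and φ^maj finally inserts n into
-- the gap labelled 0, the end of the word, so τ ends in n as well. Otherwise all labels
-- of U⁺ and B are positive, and a positive label names a gap before the last letter,
-- so τ ends in the last letter of its n-free part; by induction that is the last
-- letter of the n-free part of σ, which is the last letter of σ.
module Submission where

open import Defs
open import Data.Bool using (Bool; true; false; T; _∧_; if_then_else_)
open import Data.Bool.Properties using (T-≡; ¬-not)
open import Data.Bool.ListAction using (all)
open import Data.Nat using (ℕ; zero; suc; _<_; _≤_; _≡ᵇ_; _<ᵇ_; _∸_; z<s; s≤s)
open import Data.Nat.Properties
  using (≡ᵇ⇒≡; ≡⇒≡ᵇ; <ᵇ⇒<; <⇒<ᵇ; _≟_; <⇒≢; <⇒≤; ≤⇒≯; ≤∧≢⇒<; ≤-pred; ≤-refl;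
         <-trans; <-≤-trans; m≤n⇒m≤1+n)
open import Data.List
  using (List; []; _∷_; _++_; [_]; length; concat; concatMap; reverse; downFrom; take; drop;
         foldl; map; replicate; applyDownFrom; last)
open import Data.List.Properties
  using (filter-++; take++drop≡id; ++-conicalʳ; ++-identityʳ; foldl-++; concatMap-++; downFrom-∷ʳ;
         unfold-reverse; concat-++; reverse-involutive)
open import Data.List.Relation.Unary.All as All using (All; []; _∷_)
open import Data.List.Relation.Unary.All.Properties
  using (++⁺; concat⁺; take⁺; drop⁺; filter⁺; map⁺; replicate⁺; applyUpTo⁺₁; applyDownFrom⁺₂)
open import Data.List.Relation.Unary.Linked using (_∷_)
open import Data.List.Relation.Unary.Linked.Properties
  using (Linked⇒All) renaming (filter⁺ to Linked-filter⁺)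
open import Data.List.Relation.Binary.Permutation.Propositional using (↭-sym)
open import Data.List.Relation.Binary.Permutation.Propositional.Properties using (All-resp-↭; ↭-reverse)
open import Data.Maybe using (Maybe; just; nothing)
open import Data.Maybe.Relation.Unary.Any as Maybe using (Any; just)
open import Data.Product using (_×_; _,_; proj₁; proj₂)
open import Data.Unit using (⊤; tt)
open import Function using (_∘_; flip)
open import Function.Bundles using (Equivalence)
open import Relation.Binary.PropositionalEquality
  using (_≡_; _≢_; refl; sym; trans; cong; cong₂; subst; module ≡-Reasoning)
open import Relation.Nullary using (yes; no; contradiction)

open ≡-Reasoning

≡ᵇ-refl : ∀ n → (n ≡ᵇ n) ≡ true
≡ᵇ-refl n = Equivalence.to T-≡ (≡⇒≡ᵇ n n refl)

≢⇒≡ᵇ-false : ∀ {m n} → m ≢ n → (m ≡ᵇ n) ≡ false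
≢⇒≡ᵇ-false {m} {n} m≢n = ¬-not {y = true} (m≢n ∘ ≡ᵇ⇒≡ m n ∘ Equivalence.from T-≡)

≡ᵇ-false⇒≢ : ∀ {m n} → (m ≡ᵇ n) ≡ false → m ≢ n
≡ᵇ-false⇒≢ {m} {n} e m≡n = subst T e (≡⇒≡ᵇ m n m≡n)

≤⇒<ᵇ-false : ∀ {m n} → m ≤ n → (n <ᵇ m) ≡ false
≤⇒<ᵇ-false {m} {n} m≤n = ¬-not {y = true} (≤⇒≯ m≤n ∘ <ᵇ⇒< n m ∘ Equivalence.from T-≡)

<⇒<ᵇ-true : ∀ {m n} → m < n → (m <ᵇ n) ≡ true
<⇒<ᵇ-true = Equivalence.to T-≡ ∘ <⇒<ᵇ

All-reverse : ∀ {A : Set} {P : A → Set} {xs} → All P xs → All P (reverse xs)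
All-reverse {xs = xs} = All-resp-↭ (↭-sym (↭-reverse xs))

last-∷ : ∀ {A : Set} (x : A) xs → xs ≢ [] → last (x ∷ xs) ≡ last xs
last-∷ x []      xs≢[] = contradiction refl xs≢[]
last-∷ x (_ ∷ _) _     = refl

last-++ : ∀ {A : Set} (xs : List A) {ys} → ys ≢ [] → last (xs ++ ys) ≡ last ys
last-++ []       ys≢[] = refl
last-++ (x ∷ xs) ys≢[] = trans (last-∷ x (xs ++ _) (ys≢[] ∘ ++-conicalʳ xs _)) (last-++ xs ys≢[])

All⇒Any-last : ∀ {A : Set} {P : A → Set} {x xs} → All P (x ∷ xs) → Any P (last (x ∷ xs))
All⇒Any-last (px ∷ [])            = just px
All⇒Any-last (_ ∷ pxs@(_ ∷ _)) = All⇒Any-last pxs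

Any-last⇒≢[] : ∀ {A : Set} {P : A → Set} {xs : List A} → Any P (last xs) → xs ≢ []
Any-last⇒≢[] {xs = []}    ()
Any-last⇒≢[] {xs = _ ∷ _} _ ()

concat-reverse-∷ : ∀ {A : Set} (b : List A) bs → concat (reverse (b ∷ bs)) ≡ concat (reverse bs) ++ b
concat-reverse-∷ b bs = begin
  concat (reverse (b ∷ bs))      ≡⟨ cong concat (unfold-reverse b bs) ⟩
  concat (reverse bs ++ [ b ])   ≡⟨ concat-++ (reverse bs) [ b ] ⟨
  concat (reverse bs) ++ b ++ [] ≡⟨ cong (concat (reverse bs) ++_) (++-identityʳ b) ⟩
  concat (reverse bs) ++ b       ∎

last-concat-reverse-∷ : ∀ {A : Set} (b : List A) bs → b ≢ [] →
  last (concat (reverse (b ∷ bs))) ≡ last b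
last-concat-reverse-∷ b bs b≢[] =
  trans (cong last (concat-reverse-∷ b bs)) (last-++ (concat (reverse bs)) b≢[])

foldl-preserves : ∀ {A B : Set} (f : A → B → A) {Q : B → Set} (P : A → Set) →
  (∀ a x → Q x → P a → P (f a x)) → ∀ {a xs} → All Q xs → P a → P (foldl f a xs)
foldl-preserves f P step []         pa = pa
foldl-preserves f P step (qx ∷ qxs) pa = foldl-preserves f P step qxs (step _ _ qx pa)

removeLetter-≡ : ∀ n xs → removeLetter n (n ∷ xs) ≡ removeLetter n xs
removeLetter-≡ n xs rewrite ≡ᵇ-refl n = refl

removeLetter-≢ : ∀ {n x} xs → x ≢ n → removeLetter n (x ∷ xs) ≡ x ∷ removeLetter n xs
removeLetter-≢ xs x≢n rewrite ≢⇒≡ᵇ-false x≢n = refl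

removeLetter-++ : ∀ n xs ys → removeLetter n (xs ++ ys) ≡ removeLetter n xs ++ removeLetter n ys
removeLetter-++ n = filter-++ _

removeLetter-< : ∀ {n xs} → All (_< n) xs → removeLetter n xs ≡ xs
removeLetter-< []           = refl
removeLetter-< (x<n ∷ xs<n) = trans (removeLetter-≢ _ (<⇒≢ x<n)) (cong (_ ∷_) (removeLetter-< xs<n))

removeLetter-∉ : ∀ n xs → mem n xs ≡ false → removeLetter n xs ≡ xs
removeLetter-∉ n []       _ = refl
removeLetter-∉ n (y ∷ ys) e with y ≡ᵇ n
removeLetter-∉ n (y ∷ ys) e  | false = cong (y ∷_) (removeLetter-∉ n ys e)
removeLetter-∉ n (y ∷ ys) () | true

removeLetter-bounded : ∀ {m xs} → All (_≤ suc m) xs → All (_≤ m) (removeLetter (suc m) xs)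
removeLetter-bounded [] = []
removeLetter-bounded {m} {x ∷ xs} (x≤ ∷ xs≤) with x ≟ suc m
... | yes refl rewrite removeLetter-≡ (suc m) xs = removeLetter-bounded xs≤
... | no x≢   rewrite removeLetter-≢ xs x≢ = ≤-pred (≤∧≢⇒< x≤ x≢) ∷ removeLetter-bounded xs≤

last-removeLetter : ∀ {n} xs → Any (_< n) (last xs) → last (removeLetter n xs) ≡ last xs
last-removeLetter []       ()
last-removeLetter (x ∷ []) (just x<n) = cong last (removeLetter-≢ [] (<⇒≢ x<n))
last-removeLetter {n} (x ∷ y ∷ ys) a with x ≟ n | last-removeLetter (y ∷ ys) a
... | yes refl | ih = trans (cong last (removeLetter-≡ n (y ∷ ys))) ih
... | no x≢n   | ih = begin
  last (removeLetter n (x ∷ y ∷ ys)) ≡⟨ cong last (removeLetter-≢ (y ∷ ys) x≢n) ⟩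
  last (x ∷ removeLetter n (y ∷ ys)) ≡⟨ last-∷ x (removeLetter n (y ∷ ys)) rest≢[] ⟩
  last (removeLetter n (y ∷ ys))     ≡⟨ ih ⟩
  last (y ∷ ys)                      ∎
  where
  rest≢[] = Any-last⇒≢[] (subst (Any (_< n)) (sym ih) a)

maxIfLast : ℕ → Maybe ℕ → List ℕ
maxIfLast n (just x) = if x ≡ᵇ n then n ∷ [] else []
maxIfLast n nothing  = []

all-<ᵇ-removeLetter : ∀ {n x} ys → x < n → all (x <ᵇ_) (removeLetter n ys) ≡ all (x <ᵇ_) ys
all-<ᵇ-removeLetter [] _ = refl
all-<ᵇ-removeLetter {n} {x} (y ∷ ys) x<n with y ≟ n
... | yes refl rewrite removeLetter-≡ n ys | <⇒<ᵇ-true x<n = all-<ᵇ-removeLetter ys x<n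
... | no y≢n   rewrite removeLetter-≢ ys y≢n = cong ((x <ᵇ y) ∧_) (all-<ᵇ-removeLetter ys x<n)

rlMin-removeLetter : ∀ {n} w → All (_≤ n) w →
  rlMin w ≡ rlMin (removeLetter n w) ++ maxIfLast n (last w)
rlMin-removeLetter [] [] = refl
rlMin-removeLetter {n} (x ∷ []) (x≤n ∷ []) with x ≟ n
... | yes refl rewrite removeLetter-≡ n [] | ≡ᵇ-refl n = refl
... | no x≢n   rewrite removeLetter-≢ [] x≢n | ≢⇒≡ᵇ-false x≢n = refl
rlMin-removeLetter {n} (x ∷ y ∷ ys) (x≤n ∷ y≤n ∷ ys≤n)
  with rlMin-removeLetter (y ∷ ys) (y≤n ∷ ys≤n) | x ≟ n
... | ih | yes refl rewrite removeLetter-≡ n (y ∷ ys) | ≤⇒<ᵇ-false y≤n = ih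
... | ih | no x≢n
  rewrite removeLetter-≢ (y ∷ ys) x≢n | all-<ᵇ-removeLetter (y ∷ ys) (≤∧≢⇒< x≤n x≢n)
  with all (x <ᵇ_) (y ∷ ys)
...   | true  = cong (x ∷_) ih
...   | false = ih

rlMin-determined : ∀ {n σ τ} → All (_≤ n) σ → All (_≤ n) τ →
  rlMin (removeLetter n σ) ≡ rlMin (removeLetter n τ) → last σ ≡ last τ → rlMin σ ≡ rlMin τ
rlMin-determined {n} {σ} {τ} σ≤n τ≤n rl≡ last≡ = begin
  rlMin σ                                          ≡⟨ rlMin-removeLetter σ σ≤n ⟩
  rlMin (removeLetter n σ) ++ maxIfLast n (last σ) ≡⟨ cong₂ _++_ rl≡ (cong (maxIfLast n) last≡) ⟩
  rlMin (removeLetter n τ) ++ maxIfLast n (last τ) ≡⟨ rlMin-removeLetter τ τ≤n ⟨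
  rlMin τ                                          ∎

insertWord≢[] : ∀ g n σ → insertWord g n σ ≢ []
insertWord≢[] g n σ = (λ ()) ∘ ++-conicalʳ (take g σ) _

All-insertWord : ∀ {P : ℕ → Set} {n} g σ → All P σ → P n → All P (insertWord g n σ)
All-insertWord g σ ps pn = ++⁺ (take⁺ g ps) (pn ∷ drop⁺ g ps)

removeLetter-insertWord : ∀ n g σ → removeLetter n (insertWord g n σ) ≡ removeLetter n σ
removeLetter-insertWord n g σ = begin
  removeLetter n (take g σ ++ n ∷ drop g σ)
    ≡⟨ removeLetter-++ n (take g σ) _ ⟩
  removeLetter n (take g σ) ++ removeLetter n (n ∷ drop g σ)
    ≡⟨ cong (removeLetter n (take g σ) ++_) (removeLetter-≡ n _) ⟩
  removeLetter n (take g σ) ++ removeLetter n (drop g σ)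
    ≡⟨ removeLetter-++ n (take g σ) _ ⟨
  removeLetter n (take g σ ++ drop g σ)
    ≡⟨ cong (removeLetter n) (take++drop≡id g σ) ⟩
  removeLetter n σ
    ∎

last-insertWord-< : ∀ n {g} σ → g < length σ → last (insertWord g n σ) ≡ last σ
last-insertWord-< n {zero}  (x ∷ xs)         _        = refl
last-insertWord-< n {suc g} (x ∷ xs@(_ ∷ _)) (s≤s g<) =
  trans (last-∷ x (insertWord g n xs) (insertWord≢[] g n xs)) (last-insertWord-< n xs g<)

last-insertWord-length : ∀ n σ → last (insertWord (length σ) n σ) ≡ just n
last-insertWord-length n []       = refl
last-insertWord-length n (x ∷ xs) =
  trans (last-∷ x (insertWord (length xs) n xs) (insertWord≢[] (length xs) n xs))
        (last-insertWord-length n xs)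

at0⁺ : ∀ {P : ℕ → Set} xs i → P 0 → All P xs → P (at0 xs i)
at0⁺ []       i       p0 _         = p0
at0⁺ (x ∷ xs) zero    p0 (px ∷ _)  = px
at0⁺ (x ∷ xs) (suc i) p0 (_ ∷ pxs) = at0⁺ xs i p0 pxs

gapOf-suc-< : ∀ x xs S j → gapOf (x ∷ xs , S) (suc j) < length (x ∷ xs)
gapOf-suc-< x xs S j = at0⁺ _ j z<s (++⁺ (All-reverse (filter⁺ _ inner<)) (z<s ∷ filter⁺ _ inner<))
  where
  inner< : All (_< length (x ∷ xs)) (innerGaps (x ∷ xs))
  inner< = applyUpTo⁺₁ suc (length xs) s≤s

last-majStep-suc : ∀ n (w : StarredWord) j b → proj₁ w ≢ [] →
  last (proj₁ (majStep n w (suc j , b))) ≡ last (proj₁ w)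
last-majStep-suc n ([]     , S) j b w≢[] = contradiction refl w≢[]
last-majStep-suc n (x ∷ xs , S) j b _ = last-insertWord-< n (x ∷ xs) (gapOf-suc-< x xs S j)

last-majStep-0 : ∀ n (w : StarredWord) b → last (proj₁ (majStep n w (0 , b))) ≡ just n
last-majStep-0 n (σ , S) _ = last-insertWord-length n σ

removalsAt : List ℕ → List ℕ → ℕ → List (ℕ × Bool)
removalsAt U⁺ B i = replicate (countℕ i B) (i , false) ++ (if mem i U⁺ then (i , true) ∷ [] else [])

positiveRemovals : ℕ → List ℕ → List ℕ → List (ℕ × Bool)
positiveRemovals ℓ U B = concatMap (removalsAt (map suc U) B) (applyDownFrom suc ℓ)

removalsAt-labels : ∀ U⁺ B i → All ((_≡ i) ∘ proj₁) (removalsAt U⁺ B i)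
removalsAt-labels U⁺ B i with mem i U⁺
... | true  = ++⁺ (replicate⁺ _ refl) (refl ∷ [])
... | false = ++⁺ (replicate⁺ _ refl) []

positiveRemovals-labels : ∀ ℓ U B → All ((0 <_) ∘ proj₁) (positiveRemovals ℓ U B)
positiveRemovals-labels ℓ U B = concat⁺ (map⁺ (applyDownFrom⁺₂ suc ℓ positive))
  where
  positive : ∀ j → All ((0 <_) ∘ proj₁) (removalsAt (map suc U) B (suc j))
  positive j = All.map (λ { refl → z<s }) (removalsAt-labels (map suc U) B (suc j))

mem-0-map-suc : ∀ U → mem 0 (map suc U) ≡ false
mem-0-map-suc []      = refl
mem-0-map-suc (_ ∷ U) = mem-0-map-suc U

countℕ-0-positive : ∀ {B} → All (0 <_) B → countℕ 0 B ≡ 0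
countℕ-0-positive []                    = refl
countℕ-0-positive {suc _ ∷ _} (_ ∷ B>0) = countℕ-0-positive B>0

majSequence-split : ∀ ℓ U B →
  majSequence ℓ (map suc U) B ≡ positiveRemovals ℓ U B ++ replicate (countℕ 0 B) (0 , false)
majSequence-split ℓ U B = begin
  concatMap f (downFrom (suc ℓ))                 ≡⟨ cong (concatMap f) (downFrom-∷ʳ ℓ) ⟨
  concatMap f (applyDownFrom suc ℓ ++ [ 0 ])     ≡⟨ concatMap-++ f (applyDownFrom suc ℓ) [ 0 ] ⟩
  positiveRemovals ℓ U B ++ f 0 ++ []            ≡⟨ cong (positiveRemovals ℓ U B ++_) f0 ⟩
  positiveRemovals ℓ U B ++ replicate (countℕ 0 B) (0 , false) ∎
  where
  f = removalsAt (map suc U) B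
  f0 : f 0 ++ [] ≡ replicate (countℕ 0 B) (0 , false)
  f0 rewrite mem-0-map-suc U = trans (++-identityʳ _) (++-identityʳ _)

majSequence-[] : ∀ ℓ → majSequence ℓ [] [] ≡ []
majSequence-[] zero    = refl
majSequence-[] (suc ℓ) = majSequence-[] ℓ

phiMaj-[] : ∀ n ℓ w → phiMaj n ℓ w [] [] ≡ w
phiMaj-[] n ℓ w = cong (foldl (majStep n) w) (majSequence-[] ℓ)

phiMaj-split : ∀ n ℓ w U B → phiMaj n ℓ w U B ≡
  foldl (majStep n) (foldl (majStep n) w (positiveRemovals ℓ U B)) (replicate (countℕ 0 B) (0 , false))
phiMaj-split n ℓ w U B = trans (cong (foldl (majStep n) w) (majSequence-split ℓ U B))
  (foldl-++ (majStep n) w (positiveRemovals ℓ U B) (replicate (countℕ 0 B) (0 , false)))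

phiMaj-bounded : ∀ n ℓ w U B → All (_≤ n) (proj₁ w) → All (_≤ n) (proj₁ (phiMaj n ℓ w U B))
phiMaj-bounded n ℓ w U B =
  foldl-preserves (majStep n) {Q = λ _ → ⊤} (All (_≤ n) ∘ proj₁) step
    (All.universal (λ _ → tt) (majSequence ℓ (map suc U) B))
  where
  step : ∀ v x → ⊤ → All (_≤ n) (proj₁ v) → All (_≤ n) (proj₁ (majStep n v x))
  step (σ , S) (i , _) _ σ≤n = All-insertWord (gapOf (σ , S) i) σ σ≤n ≤-refl

removeLetter-phiMaj : ∀ n ℓ w U B →
  removeLetter n (proj₁ (phiMaj n ℓ w U B)) ≡ removeLetter n (proj₁ w)
removeLetter-phiMaj n ℓ w U B =
  foldl-preserves (majStep n) {Q = λ _ → ⊤}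
    (λ v → removeLetter n (proj₁ v) ≡ removeLetter n (proj₁ w))
    step (All.universal (λ _ → tt) (majSequence ℓ (map suc U) B)) refl
  where
  step : ∀ v x → ⊤ → removeLetter n (proj₁ v) ≡ removeLetter n (proj₁ w) →
    removeLetter n (proj₁ (majStep n v x)) ≡ removeLetter n (proj₁ w)
  step (σ , S) (i , _) _ = trans (removeLetter-insertWord n (gapOf (σ , S) i) σ)

last-foldl-positive : ∀ {P : ℕ → Set} n {xs} w → All ((0 <_) ∘ proj₁) xs →
  Any P (last (proj₁ w)) → last (proj₁ (foldl (majStep n) w xs)) ≡ last (proj₁ w)
last-foldl-positive {P} n w labels>0 a =
  foldl-preserves (majStep n) (λ v → last (proj₁ v) ≡ last (proj₁ w)) step labels>0 refl
  where
  step : ∀ v x → 0 < proj₁ x → last (proj₁ v) ≡ last (proj₁ w) →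
    last (proj₁ (majStep n v x)) ≡ last (proj₁ w)
  step v (suc j , b) _ e = trans (last-majStep-suc n v j b (Any-last⇒≢[] (subst (Any P) (sym e) a))) e

last-foldl-0 : ∀ n c w → last (proj₁ (foldl (majStep n) w (replicate (suc c) (0 , false)))) ≡ just n
last-foldl-0 n zero    w = last-majStep-0 n w false
last-foldl-0 n (suc c) w = last-foldl-0 n c (majStep n w (0 , false))

last-phiMaj-0 : ∀ n ℓ w U B → last (proj₁ (phiMaj n ℓ w U (0 ∷ B))) ≡ just n
last-phiMaj-0 n ℓ w U B rewrite phiMaj-split n ℓ w U (0 ∷ B) =
  last-foldl-0 n (countℕ 0 B) (foldl (majStep n) w (positiveRemovals ℓ U (0 ∷ B)))

last-phiMaj-positive : ∀ {P : ℕ → Set} n ℓ w U {B} → All (0 <_) B → Any P (last (proj₁ w)) →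
  last (proj₁ (phiMaj n ℓ w U B)) ≡ last (proj₁ w)
last-phiMaj-positive n ℓ w U {B} B>0 a rewrite phiMaj-split n ℓ w U B | countℕ-0-positive B>0 =
  last-foldl-positive n w (positiveRemovals-labels ℓ U B) a

record IsBlock (m : ℕ) (b : Block) : Set where
  field
    nonempty   : b ≢ []
    decreasing : StrictDecr b
    bounded    : All (_≤ m) b

blocks-bounded : ∀ {m ρ} → All (IsBlock m) ρ → All (_≤ m) (concat ρ)
blocks-bounded = concat⁺ ∘ All.map IsBlock.bounded

isSingleton⇒≡ : ∀ n b → isSingleton n b ≡ true → b ≡ n ∷ []
isSingleton⇒≡ n []          ()
isSingleton⇒≡ n (x ∷ [])    e = cong [_] (≡ᵇ⇒≡ x n (Equivalence.from T-≡ e))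
isSingleton⇒≡ n (_ ∷ _ ∷ _) ()

-- A decreasing block over [1, n] can contain n only as its first letter.
last-nonSingleton : ∀ {n b} → IsBlock n b → isSingleton n b ≡ false → Any (_< n) (last b)
last-nonSingleton {b = []} blk _ = contradiction refl (IsBlock.nonempty blk)
last-nonSingleton {b = x ∷ []} blk e = just (≤∧≢⇒< x≤n (≡ᵇ-false⇒≢ e))
  where
  x≤n = All.head (IsBlock.bounded blk)
last-nonSingleton {b = x ∷ y ∷ r} blk _ with IsBlock.decreasing blk | IsBlock.bounded blk
... | x>y ∷ dec | x≤n ∷ _ =
  Maybe.map (flip <-≤-trans x≤n) (All⇒Any-last (Linked⇒All (flip <-trans) x>y dec))

last-concat-reverse-nonSingleton : ∀ {n b} bs → IsBlock n b → isSingleton n b ≡ false →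
  Any (_< n) (last (concat (reverse (b ∷ bs))))
last-concat-reverse-nonSingleton {n} {b} bs blk e =
  subst (Any (_< n)) (sym (last-concat-reverse-∷ b bs (IsBlock.nonempty blk))) (last-nonSingleton blk e)

IsBlock-removeLetter : ∀ {m b} → IsBlock (suc m) b → isSingleton (suc m) b ≡ false →
  IsBlock m (removeLetter (suc m) b)
IsBlock-removeLetter {b = b} blk e = record
  { nonempty   = Any-last⇒≢[] (subst (Any _) (sym (last-removeLetter b a)) a)
  ; decreasing = Linked-filter⁺ _ (flip <-trans) (IsBlock.decreasing blk)
  ; bounded    = removeLetter-bounded (IsBlock.bounded blk)
  }
  where
  a = last-nonSingleton blk e

concat-reverse-removeLetter-∷ : ∀ n b bs b′ π → b′ ≡ removeLetter n b →
  concat (reverse π) ≡ removeLetter n (concat (reverse bs)) →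
  concat (reverse (b′ ∷ π)) ≡ removeLetter n (concat (reverse (b ∷ bs)))
concat-reverse-removeLetter-∷ n b bs b′ π refl ih = begin
  concat (reverse (b′ ∷ π))
    ≡⟨ concat-reverse-∷ b′ π ⟩
  concat (reverse π) ++ b′
    ≡⟨ cong (_++ b′) ih ⟩
  removeLetter n (concat (reverse bs)) ++ removeLetter n b
    ≡⟨ removeLetter-++ n (concat (reverse bs)) b ⟨
  removeLetter n (concat (reverse bs) ++ b)
    ≡⟨ cong (removeLetter n) (concat-reverse-∷ b bs) ⟨
  removeLetter n (concat (reverse (b ∷ bs)))
    ∎

invAux-concat : ∀ n c bs →
  concat (reverse (proj₁ (invAux n c bs))) ≡ removeLetter n (concat (reverse bs))
invAux-concat n c [] = refl
invAux-concat n c (b ∷ bs) with isSingleton n b in s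
... | true = trans (sym (trans (concat-reverse-∷ [] π) (++-identityʳ _)))
                   (concat-reverse-removeLetter-∷ n b bs [] π []≡ (invAux-concat n c bs))
  where
  π = proj₁ (invAux n c bs)
  []≡ : [] ≡ removeLetter n b
  []≡ = sym (trans (cong (removeLetter n) (isSingleton⇒≡ n b s)) (removeLetter-≡ n []))
... | false with mem n b in n∈b
...   | true  = concat-reverse-removeLetter-∷ n b bs (removeLetter n b) (proj₁ (invAux n (suc c) bs))
                  refl (invAux-concat n (suc c) bs)
...   | false = concat-reverse-removeLetter-∷ n b bs b (proj₁ (invAux n (suc c) bs))
                  (sym (removeLetter-∉ n b n∈b)) (invAux-concat n (suc c) bs)

invAux-blocks : ∀ {m} c bs → All (IsBlock (suc m)) bs → All (IsBlock m) (proj₁ (invAux (suc m) c bs))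
invAux-blocks c [] [] = []
invAux-blocks {m} c (b ∷ bs) (blk ∷ blks) with isSingleton (suc m) b in s
... | true = invAux-blocks c bs blks
... | false with mem (suc m) b in n∈b
...   | true  = IsBlock-removeLetter blk s ∷ invAux-blocks (suc c) bs blks
...   | false = subst (IsBlock m) (removeLetter-∉ (suc m) b n∈b) (IsBlock-removeLetter blk s)
                  ∷ invAux-blocks (suc c) bs blks

invAux-B-≥ : ∀ n c bs → All (c ≤_) (proj₂ (proj₂ (invAux n c bs)))
invAux-B-≥ n c [] = []
invAux-B-≥ n c (b ∷ bs) with isSingleton n b
... | true = ≤-refl ∷ invAux-B-≥ n c bs
... | false with mem n b
...   | true  = All.map <⇒≤ (invAux-B-≥ n (suc c) bs)
...   | false = All.map <⇒≤ (invAux-B-≥ n (suc c) bs)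

-- How the rightmost block of ρ shows up in σ = concat ρ and in (U , B).
data EndView (n : ℕ) : List ℕ → List ℕ → List ℕ → Set where
  empty             : EndView n [] [] []
  endsWithSingleton : ∀ {σ U B} → last σ ≡ just n → EndView n σ U (0 ∷ B)
  endsBelow         : ∀ {σ U B} → All (0 <_) B → Any (_< n) (last σ) → EndView n σ U B

endView : ∀ n rs → All (IsBlock n) rs →
  EndView n (concat (reverse rs)) (proj₁ (proj₂ (invAux n 0 rs))) (proj₂ (proj₂ (invAux n 0 rs)))
endView n [] [] = empty
endView n (b ∷ bs) (blk ∷ _) with isSingleton n b in s
... | true rewrite isSingleton⇒≡ n b s = endsWithSingleton (last-concat-reverse-∷ (n ∷ []) bs (λ ()))
... | false with mem n b
...   | true  = endsBelow (invAux-B-≥ n 1 bs) (last-concat-reverse-nonSingleton bs blk s)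
...   | false = endsBelow (invAux-B-≥ n 1 bs) (last-concat-reverse-nonSingleton bs blk s)

last-phiMaj : ∀ {n σ U B} ℓ w → EndView n σ U B → last (removeLetter n σ) ≡ last (proj₁ w) →
  last σ ≡ last (proj₁ (phiMaj n ℓ w U B))
last-phiMaj {n} ℓ w empty e = trans e (cong (last ∘ proj₁) (sym (phiMaj-[] n ℓ w)))
last-phiMaj {n} {U = U} ℓ w (endsWithSingleton {B = B} l) _ = trans l (sym (last-phiMaj-0 n ℓ w U B))
last-phiMaj {n} {σ} {U} {B} ℓ w (endsBelow B>0 a) e = begin
  last σ                          ≡⟨ last-removeLetter σ a ⟨
  last (removeLetter n σ)         ≡⟨ e ⟩
  last (proj₁ w)                  ≡⟨ last-phiMaj-positive n ℓ w U B>0 (subst (Any (_< n)) σ≡w a) ⟨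
  last (proj₁ (phiMaj n ℓ w U B)) ∎
  where
  σ≡w = trans (sym (last-removeLetter σ a)) e

SameEnds : List ℕ → List ℕ → Set
SameEnds σ τ = rlMin σ ≡ rlMin τ × last σ ≡ last τ

phiMaj-sameEnds : ∀ {m σ U B} ℓ w → EndView (suc m) σ U B → All (_≤ suc m) σ →
  SameEnds (removeLetter (suc m) σ) (proj₁ w) → All (_≤ m) (proj₁ w) →
  SameEnds σ (proj₁ (phiMaj (suc m) ℓ w U B)) × All (_≤ suc m) (proj₁ (phiMaj (suc m) ℓ w U B))
phiMaj-sameEnds {m} {σ} {U} {B} ℓ w view σ≤n (rl≡ , last≡) w≤m =
  (rlMin-determined σ≤n τ≤n (trans rl≡ (cong rlMin (sym τ-without-n))) lastEq , lastEq) , τ≤n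
  where
  n = suc m
  τ = proj₁ (phiMaj n ℓ w U B)
  τ≤n : All (_≤ n) τ
  τ≤n = phiMaj-bounded n ℓ w U B (All.map m≤n⇒m≤1+n w≤m)
  τ-without-n : removeLetter n τ ≡ proj₁ w
  τ-without-n = trans (removeLetter-phiMaj n ℓ w U B) (removeLetter-< (All.map s≤s w≤m))
  lastEq : last σ ≡ last τ
  lastEq = last-phiMaj ℓ w view last≡

psiAux-sameEnds : ∀ m k ρ → All (IsBlock m) ρ →
  SameEnds (concat ρ) (proj₁ (psiAux m k ρ)) × All (_≤ m) (proj₁ (psiAux m k ρ))
psiAux-sameEnds zero          k ρ blks = (refl , refl) , blocks-bounded blks
psiAux-sameEnds (suc zero)    k ρ blks = (refl , refl) , blocks-bounded blks
psiAux-sameEnds (suc (suc m)) k ρ blks = extend (psiAux-sameEnds (suc m) ℓ π π-blocks)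
  where
  n = suc (suc m)
  inv = invAux n 0 (reverse ρ)
  π = reverse (proj₁ inv)
  ℓ = k ∸ length (proj₂ (proj₂ inv))
  π-blocks : All (IsBlock (suc m)) π
  π-blocks = All-reverse (invAux-blocks 0 (reverse ρ) (All-reverse blks))
  concat-π : concat π ≡ removeLetter n (concat ρ)
  concat-π = trans (invAux-concat n 0 (reverse ρ)) (cong (removeLetter n ∘ concat) (reverse-involutive ρ))
  view : EndView n (concat ρ) (proj₁ (proj₂ inv)) (proj₂ (proj₂ inv))
  view = subst (λ ρ′ → EndView n (concat ρ′) (proj₁ (proj₂ inv)) (proj₂ (proj₂ inv)))
           (reverse-involutive ρ) (endView n (reverse ρ) (All-reverse blks))
  τ′ = psiAux (suc m) ℓ π
  extend : SameEnds (concat π) (proj₁ τ′) × All (_≤ suc m) (proj₁ τ′) →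
    SameEnds (concat ρ) (proj₁ (psiAux n k ρ)) × All (_≤ n) (proj₁ (psiAux n k ρ))
  extend (ends , bounded) =
    phiMaj-sameEnds ℓ τ′ view (blocks-bounded blks)
      (subst (λ σ → SameEnds σ (proj₁ τ′)) concat-π ends) bounded

corollary3p5 : (α : List ℕ) → IsComposition α → (k : ℕ) → 0 < k →
    (ρ : OMP) → IsOP α k ρ →
    (rlMin (proj₁ (toStarred ρ)) ≡ rlMin (proj₁ (psi α k ρ)))
    × (last (proj₁ (toStarred ρ)) ≡ last (proj₁ (psi α k ρ)))
corollary3p5 α _ k _ ρ isOP = proj₁ (psiAux-sameEnds (length α) k ρ blocks)
  where
  open IsOP isOP
  blocks : All (IsBlock (length α)) ρ
  blocks = All.zipWith
    (λ (ne , dec , range) → record { nonempty = ne ; decreasing = dec ; bounded = All.map proj₂ range })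
    (blocksNonempty , All.zip (blocksSets , entriesInRange))
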